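{- For every integer $k\ge 2$, $\gamma(k)\ge 2\,\gamma(k-1)+1$.
   Context: A word is a finite sequence of letters. An occurrence of a word $C$ as a subsequence of a word $S$ is an increasing sequence of positions $i_0<\cdots<i_{|C|-1}$ of $S$ with $S[i_j]=C[j]$. $C$ is an s-cover of $S$ if every position of $S$ lies in some occurrence of $C$ as a subsequence of $S$. An s-cover $C$ of $S$ is non-trivial if $|C|<|S|$; $S$ is s-primitive if it has no non-trivial s-cover. $\gamma(k)$ denotes the length of a longest s-primitive word over an alphabet of size $k$. -}

module Defs where

open import Data.Nat using (ℕ; _<_; _≤_)
open import Data.Fin using (Fin) renaming (_<_ to _<ᶠ_)
open import Data.List using (List; length; lookup)
open import Data.Product using (Σ; ∃; _×_)
open import Relation.Binary.PropositionalEquality using (_≡_)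
open import Relation.Nullary using (¬_)

Word : ℕ → Set
Word k = List (Fin k)

Occurrence : ∀ {k} → Word k → Word k → Set
Occurrence C S =
  Σ (Fin (length C) → Fin (length S)) λ f →
    (∀ i j → i <ᶠ j → f i <ᶠ f j) × (∀ i → lookup S (f i) ≡ lookup C i)

IsSCover : ∀ {k} → Word k → Word k → Set
IsSCover C S =
  ∀ (p : Fin (length S)) → Σ (Occurrence C S) λ o → ∃ λ i → Σ.proj₁ o i ≡ p
  where open import Data.Product as Σ using ()

SPrimitive : ∀ {k} → Word k → Set
SPrimitive {k} S = ∀ (C : Word k) → IsSCover C S → ¬ (length C < length S)

IsGamma : ℕ → ℕ → Set
IsGamma k n = (∃ λ (w : Word k) → SPrimitive w × length w ≡ n)
            × (∀ (w : Word k) → SPrimitive w → length w ≤ n)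

GammaAtLeast : ℕ → ℕ → Set
GammaAtLeast k N = ∃ λ (w : Word k) → SPrimitive w × N ≤ length w

-- If w is s-primitive over N letters and c is a fresh letter, then w c w is s-primitive.
-- In an s-cover C of w c w the middle position forces a letter c in C, and since c occurs
-- only once every occurrence of C sends that index i to the middle.  By monotonicity every
-- occurrence then sends the part of C before i exactly onto the left copy of w and the part
-- after i exactly onto the right copy.  Reading each part back in w yields an s-cover of w,
-- so each part has length at least |w|, and |C| ≥ 2|w| + 1 = |w c w|.

{-# OPTIONS --safe #-}
module Submission where

open import Data.Nat using (ℕ; _≤_; _+_; _*_; _∸_)
open import Defs

open import Data.Nat using (suc; s≤s; z≤n; z<s; _<_)
open import Data.Nat.Properties
open import Data.Fin as Fin using (Fin; toℕ; fromℕ; fromℕ<; inject₁; cast)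
open import Data.Fin.Properties
  using ( toℕ-injective; toℕ<n; toℕ-fromℕ<; toℕ-cast; cast-involutive
        ; fromℕ≢inject₁; inject₁-injective)
  renaming (<-cmp to <ᶠ-cmp)
open import Data.List using (List; []; _∷_; length; lookup; map; _++_; tabulate)
open import Data.List.Properties using (length-map; length-++; length-tabulate; lookup-tabulate)
open import Data.List.Relation.Unary.Any using (here; there)
open import Data.List.Membership.Propositional using (_∈_; _∉_)
open import Data.List.Membership.Propositional.Properties using (∈-lookup; ∈-map⁻)
open import Data.Product using (Σ; ∃; _×_; _,_; proj₁; proj₂)
open import Data.Empty using (⊥-elim)
open import Function using (_∘_)
open import Function.Bundles using (_⇔_; mk⇔; Equivalence)
open import Function.Definitions using (Injective)
open import Function.Properties.Equivalence using () renaming (trans to _⇔∘_; sym to ⇔-sym)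
open import Relation.Binary using (tri<; tri≈; tri>)
open import Relation.Binary.PropositionalEquality
open import Data.Nat.Tactic.RingSolver using (solve-∀)

open Equivalence using (to; from)

module _ {A : Set} where

  lookup-++ˡ : ∀ (xs ys : List A) (i : Fin (length (xs ++ ys))) (j : Fin (length xs)) →
               toℕ i ≡ toℕ j → lookup (xs ++ ys) i ≡ lookup xs j
  lookup-++ˡ (x ∷ xs) ys Fin.zero    Fin.zero    _  = refl
  lookup-++ˡ (x ∷ xs) ys (Fin.suc i) (Fin.suc j) eq = lookup-++ˡ xs ys i j (suc-injective eq)

  lookup-++ʳ : ∀ (xs ys : List A) (i : Fin (length (xs ++ ys))) (j : Fin (length ys)) →
               toℕ i ≡ length xs + toℕ j → lookup (xs ++ ys) i ≡ lookup ys j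
  lookup-++ʳ []       ys i           j eq = cong (lookup ys) (toℕ-injective eq)
  lookup-++ʳ (x ∷ xs) ys (Fin.suc i) j eq = lookup-++ʳ xs ys i j (suc-injective eq)

  lookup-++-∷-unique : ∀ {x} (xs ys : List A) (i : Fin (length (xs ++ x ∷ ys))) →
                       x ∉ xs → x ∉ ys → lookup (xs ++ x ∷ ys) i ≡ x → toℕ i ≡ length xs
  lookup-++-∷-unique []       ys Fin.zero    _    _    _  = refl
  lookup-++-∷-unique []       ys (Fin.suc i) _    x∉ys eq =
    ⊥-elim (x∉ys (subst (_∈ ys) eq (∈-lookup i)))
  lookup-++-∷-unique (y ∷ xs) ys Fin.zero    x∉xs _    eq = ⊥-elim (x∉xs (here (sym eq)))
  lookup-++-∷-unique (y ∷ xs) ys (Fin.suc i) x∉xs x∉ys eq =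
    cong suc (lookup-++-∷-unique xs ys i (x∉xs ∘ there) x∉ys eq)

  lookup-map : ∀ {B : Set} (f : A → B) (xs : List A)
               (i : Fin (length (map f xs))) (j : Fin (length xs)) →
               toℕ i ≡ toℕ j → lookup (map f xs) i ≡ f (lookup xs j)
  lookup-map f (x ∷ xs) Fin.zero    Fin.zero    _  = refl
  lookup-map f (x ∷ xs) (Fin.suc i) (Fin.suc j) eq = lookup-map f xs i j (suc-injective eq)

InInterval : ℕ → ℕ → ℕ → Set
InInterval a m x = a ≤ x × x < a + m

inInterval-zero⇔ : ∀ {m x} → InInterval 0 m x ⇔ x < m
inInterval-zero⇔ = mk⇔ proj₂ (z≤n ,_)

inInterval⇔≤ : ∀ {a m x} → x < a + m → InInterval a m x ⇔ a ≤ x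
inInterval⇔≤ x<a+m = mk⇔ proj₁ (_, x<a+m)

+-inInterval : ∀ {a m} (t : Fin m) → InInterval a m (a + toℕ t)
+-inInterval {a} t = m≤m+n a (toℕ t) , +-monoʳ-< a (toℕ<n t)

inInterval⇒+ : ∀ {a m x} → InInterval a m x → Σ (Fin m) λ t → x ≡ a + toℕ t
inInterval⇒+ {a} {m} {x} (a≤x , x<a+m) = fromℕ< x∸a<m , sym (begin
  a + toℕ (fromℕ< x∸a<m) ≡⟨ cong (a +_) (toℕ-fromℕ< x∸a<m) ⟩
  a + (x ∸ a)            ≡⟨ m+[n∸m]≡n a≤x ⟩
  x                      ∎)
  where
  open ≡-Reasoning
  x∸a<m : x ∸ a < m
  x∸a<m = subst (x ∸ a <_) (m+n∸m≡n a m) (∸-monoˡ-< x<a+m a≤x)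

shiftFin : ∀ {a m n} → a + m ≤ n → Fin m → Fin n
shiftFin {a} a+m≤n t = fromℕ< (≤-trans (+-monoʳ-< a (toℕ<n t)) a+m≤n)

toℕ-shiftFin : ∀ {a m n} (a+m≤n : a + m ≤ n) (t : Fin m) → toℕ (shiftFin a+m≤n t) ≡ a + toℕ t
toℕ-shiftFin {a} a+m≤n t = toℕ-fromℕ< (≤-trans (+-monoʳ-< a (toℕ<n t)) a+m≤n)

StrictlyIncreasing : ∀ {m n} → (Fin m → Fin n) → Set
StrictlyIncreasing φ = ∀ i j → i Fin.< j → φ i Fin.< φ j

strictlyIncreasing-<⇔ : ∀ {m n} {φ : Fin m → Fin n} → StrictlyIncreasing φ →
                        ∀ i j → i Fin.< j ⇔ φ i Fin.< φ j
strictlyIncreasing-<⇔ {φ = φ} φ↑ i j = mk⇔ (φ↑ i j) reflects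
  where
  reflects : φ i Fin.< φ j → i Fin.< j
  reflects φi<φj with <ᶠ-cmp i j
  ... | tri< i<j _ _ = i<j
  ... | tri≈ _ refl _ = ⊥-elim (<-irrefl refl φi<φj)
  ... | tri> _ _ j<i = ⊥-elim (<-asym φi<φj (φ↑ j i j<i))

Occurrenceᶠ : ∀ {k m} → (Fin m → Fin k) → Word k → Set
Occurrenceᶠ {m = m} u S =
  Σ (Fin m → Fin (length S)) λ φ → StrictlyIncreasing φ × (∀ t → lookup S (φ t) ≡ u t)

IsSCoverᶠ : ∀ {k m} → (Fin m → Fin k) → Word k → Set
IsSCoverᶠ u S = ∀ (p : Fin (length S)) → Σ (Occurrenceᶠ u S) λ o → ∃ λ t → proj₁ o t ≡ p

tabulate-sCover : ∀ {k m} {u : Fin m → Fin k} {S : Word k} →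
                  IsSCoverᶠ u S → IsSCover (tabulate u) S
tabulate-sCover {u = u} {S} cover p with cover p
... | (φ , φ↑ , φ-letters) , t , φt≡p =
  (φ ∘ toFin , toFin-increasing , letters) , cast (sym |u|≡m) t ,
  trans (cong φ (cast-involutive |u|≡m (sym |u|≡m) t)) φt≡p
  where
  |u|≡m : length (tabulate u) ≡ _
  |u|≡m = length-tabulate u
  toFin : Fin (length (tabulate u)) → Fin _
  toFin = cast |u|≡m
  toFin-increasing : StrictlyIncreasing (φ ∘ toFin)
  toFin-increasing i j i<j = φ↑ (toFin i) (toFin j)
    (subst₂ _<_ (sym (toℕ-cast |u|≡m i)) (sym (toℕ-cast |u|≡m j)) i<j)
  letters : ∀ s → lookup S (φ (toFin s)) ≡ lookup (tabulate u) s
  letters s = trans (φ-letters (toFin s)) (sym (begin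
    lookup (tabulate u) s
      ≡⟨ cong (lookup (tabulate u)) (sym (cast-involutive (sym |u|≡m) |u|≡m s)) ⟩
    lookup (tabulate u) (cast (sym |u|≡m) (toFin s))
      ≡⟨ lookup-tabulate u (toFin s) ⟩
    u (toFin s)
      ∎))
    where open ≡-Reasoning

sPrimitive-≤-sCoverᶠ : ∀ {k m} {w : Word k} {u : Fin m → Fin k} →
                       SPrimitive w → IsSCoverᶠ u w → length w ≤ m
sPrimitive-≤-sCoverᶠ {w = w} {u} w-prim cover =
  ≮⇒≥ (w-prim (tabulate u) (tabulate-sCover {S = w} cover)
         ∘ subst (_< _) (sym (length-tabulate u)))

record IsFactorAt {N M} (f : Fin N → Fin M) (w : Word N) (S : Word M) (off : ℕ) : Set where
  field
    fits  : off + length w ≤ length S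
    reads : ∀ p q → toℕ p ≡ off + toℕ q → lookup S p ≡ f (lookup w q)

-- The letters of C live in the larger alphabet, so the block is read back in w through a
-- fixed occurrence o₀; injectivity of f makes the letters read independent of the occurrence.
module AlignedBlock {N M : ℕ} {f : Fin N → Fin M} (f-injective : Injective _≡_ _≡_ f)
  {w : Word N} {C S : Word M} (cover : IsSCover C S) {off a m : ℕ}
  (factor : IsFactorAt f w S off) (block : a + m ≤ length C)
  (aligned : ∀ (o : Occurrence C S) j →
             InInterval a m (toℕ j) ⇔ InInterval off (length w) (toℕ (proj₁ o j)))
  where

  open IsFactorAt factor

  index : Fin m → Fin (length C)
  index = shiftFin block

  index-increasing : StrictlyIncreasing index
  index-increasing s t s<t =
    subst₂ _<_ (sym (toℕ-shiftFin block s)) (sym (toℕ-shiftFin block t)) (+-monoʳ-< a s<t)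

  private
    positionΣ : ∀ (o : Occurrence C S) t →
                Σ (Fin (length w)) λ q → toℕ (proj₁ o (index t)) ≡ off + toℕ q
    positionΣ o t = inInterval⇒+ (to (aligned o (index t))
      (subst (InInterval a m) (sym (toℕ-shiftFin block t)) (+-inInterval t)))

  position : Occurrence C S → Fin m → Fin (length w)
  position o t = proj₁ (positionΣ o t)

  toℕ-position : ∀ o t → toℕ (proj₁ o (index t)) ≡ off + toℕ (position o t)
  toℕ-position o t = proj₂ (positionΣ o t)

  position-increasing : ∀ o → StrictlyIncreasing (position o)
  position-increasing o@(φ , φ↑ , _) s t s<t = +-cancelˡ-< off _ _
    (subst₂ _<_ (toℕ-position o s) (toℕ-position o t)
                (φ↑ (index s) (index t) (index-increasing s t s<t)))

  f-lookup-position : ∀ o t → f (lookup w (position o t)) ≡ lookup C (index t)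
  f-lookup-position o@(φ , _ , φ-letters) t =
    trans (sym (reads _ _ (toℕ-position o t))) (φ-letters (index t))

  lookup-position : ∀ o o′ t → lookup w (position o t) ≡ lookup w (position o′ t)
  lookup-position o o′ t = f-injective (trans (f-lookup-position o t) (sym (f-lookup-position o′ t)))

  restriction-sCover : ∀ o₀ → IsSCoverᶠ (lookup w ∘ position o₀) w
  restriction-sCover o₀ p with cover (shiftFin fits p)
  ... | o@(φ , _) , j , φj≡P =
    (position o , position-increasing o , lookup-position o o₀) , t , hits
    where
    toℕ-φj : toℕ (φ j) ≡ off + toℕ p
    toℕ-φj = trans (cong toℕ φj≡P) (toℕ-shiftFin fits p)
    tΣ : Σ (Fin m) λ t → toℕ j ≡ a + toℕ t
    tΣ = inInterval⇒+ (from (aligned o j)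
           (subst (InInterval off (length w)) (sym toℕ-φj) (+-inInterval p)))
    t : Fin m
    t = proj₁ tΣ
    index-t : index t ≡ j
    index-t = toℕ-injective (trans (toℕ-shiftFin block t) (sym (proj₂ tΣ)))
    hits : position o t ≡ p
    hits = toℕ-injective (+-cancelˡ-≡ off _ _ (begin
      off + toℕ (position o t) ≡⟨ sym (toℕ-position o t) ⟩
      toℕ (φ (index t))        ≡⟨ cong (toℕ ∘ φ) index-t ⟩
      toℕ (φ j)                ≡⟨ toℕ-φj ⟩
      off + toℕ p              ∎))
      where open ≡-Reasoning

  sPrimitive-≤-block : SPrimitive w → length w ≤ m
  sPrimitive-≤-block w-prim = ≮⇒≥ λ m<|w| →
    let o₀ = proj₁ (cover (shiftFin fits (fromℕ< (≤-<-trans z≤n m<|w|)))) in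
    <⇒≱ m<|w| (sPrimitive-≤-sCoverᶠ {w = w} w-prim (restriction-sCover o₀))

module _ {k} {C S : Word k} (o : Occurrence C S) (i : Fin (length C)) {P : ℕ}
         (pinned : toℕ (proj₁ o i) ≡ P) where

  private
    φ : Fin (length C) → Fin (length S)
    φ = proj₁ o
    φ↑ : StrictlyIncreasing φ
    φ↑ = proj₁ (proj₂ o)

  prefix-aligned : ∀ j → InInterval 0 (toℕ i) (toℕ j) ⇔ InInterval 0 P (toℕ (φ j))
  prefix-aligned j = inInterval-zero⇔ ⇔∘ (before ⇔∘ ⇔-sym inInterval-zero⇔)
    where
    before : toℕ j < toℕ i ⇔ toℕ (φ j) < P
    before = subst (λ x → toℕ j < toℕ i ⇔ toℕ (φ j) < x) pinned (strictlyIncreasing-<⇔ φ↑ j i)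

  suffix-aligned : ∀ {Q} → suc P + Q ≡ length S → ∀ j →
                   InInterval (suc (toℕ i)) (length C ∸ suc (toℕ i)) (toℕ j) ⇔
                   InInterval (suc P) Q (toℕ (φ j))
  suffix-aligned |S|-split j =
    inInterval⇔≤ (subst (toℕ j <_) (sym (m+[n∸m]≡n (toℕ<n i))) (toℕ<n j)) ⇔∘
    (after ⇔∘ ⇔-sym (inInterval⇔≤ (subst (toℕ (φ j) <_) (sym |S|-split) (toℕ<n (φ j)))))
    where
    after : toℕ i < toℕ j ⇔ P < toℕ (φ j)
    after = subst (λ x → toℕ i < toℕ j ⇔ x < toℕ (φ j)) pinned (strictlyIncreasing-<⇔ φ↑ i j)

doubled : ∀ {N} → Word N → Word (suc N)
doubled {N} w = map inject₁ w ++ fromℕ N ∷ map inject₁ w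

module _ {N} (w : Word N) where

  private
    L : Word (suc N)
    L = map inject₁ w
    |L|≡|w| : length L ≡ length w
    |L|≡|w| = length-map inject₁ w

  length-doubled : length (doubled w) ≡ length w + suc (length w)
  length-doubled = trans (length-++ L) (cong₂ (λ x y → x + suc y) |L|≡|w| |L|≡|w|)

  fromℕ∉map-inject₁ : fromℕ N ∉ map inject₁ w
  fromℕ∉map-inject₁ c∈L with ∈-map⁻ inject₁ c∈L
  ... | _ , _ , c≡inject₁ = fromℕ≢inject₁ c≡inject₁

  lookup-doubled≡fromℕ⇔ : ∀ p → lookup (doubled w) p ≡ fromℕ N ⇔ toℕ p ≡ length w
  lookup-doubled≡fromℕ⇔ p = mk⇔
    (λ eq → trans (lookup-++-∷-unique L L p fromℕ∉map-inject₁ fromℕ∉map-inject₁ eq) |L|≡|w|)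
    (λ eq → lookup-++ʳ L (fromℕ N ∷ L) p Fin.zero
              (trans eq (sym (trans (+-identityʳ _) |L|≡|w|))))

  middle : Fin (length (doubled w))
  middle = fromℕ< (subst (length w <_) (sym length-doubled) (m<m+n (length w) z<s))

  toℕ-middle : toℕ middle ≡ length w
  toℕ-middle = toℕ-fromℕ< _

  doubled-factorˡ : IsFactorAt inject₁ w (doubled w) 0
  doubled-factorˡ = record
    { fits  = ≤-trans (m≤m+n (length w) _) (≤-reflexive (sym length-doubled))
    ; reads = λ p q eq → let q′ = cast (sym |L|≡|w|) q in
        trans (lookup-++ˡ L _ p q′ (trans eq (sym (toℕ-cast _ q))))
              (lookup-map inject₁ w q′ q (toℕ-cast _ q))
    }

  doubled-factorʳ : IsFactorAt inject₁ w (doubled w) (suc (length w))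
  doubled-factorʳ = record
    { fits  = ≤-reflexive (sym (trans length-doubled (+-suc (length w) (length w))))
    ; reads = λ p q eq → let q′ = cast (sym |L|≡|w|) q in
        trans (lookup-++ʳ L (fromℕ N ∷ L) p (Fin.suc q′) (begin
                  toℕ p                    ≡⟨ eq ⟩
                  suc (length w + toℕ q)   ≡⟨ sym (+-suc (length w) (toℕ q)) ⟩
                  length w + suc (toℕ q)   ≡⟨ cong₂ (λ x y → x + suc y) (sym |L|≡|w|)
                                                        (sym (toℕ-cast _ q)) ⟩
                  length L + suc (toℕ q′)  ∎))
              (lookup-map inject₁ w q′ q (toℕ-cast _ q))
    }
    where open ≡-Reasoning

sCover-doubled-pinned : ∀ {N} (w : Word N) {C : Word (suc N)} → IsSCover C (doubled w) →
                        Σ (Fin (length C)) λ i →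
                          ∀ (o : Occurrence C (doubled w)) → toℕ (proj₁ o i) ≡ length w
sCover-doubled-pinned {N} w {C} cover with cover (middle w)
... | (φ₀ , _ , φ₀-letters) , i , φ₀i≡middle = i , pinned
  where
  C[i]≡fromℕ : lookup C i ≡ fromℕ N
  C[i]≡fromℕ = begin
    lookup C i                  ≡⟨ sym (φ₀-letters i) ⟩
    lookup (doubled w) (φ₀ i)   ≡⟨ from (lookup-doubled≡fromℕ⇔ w (φ₀ i))
                                         (trans (cong toℕ φ₀i≡middle) (toℕ-middle w)) ⟩
    fromℕ N                     ∎
    where open ≡-Reasoning
  pinned : ∀ (o : Occurrence C (doubled w)) → toℕ (proj₁ o i) ≡ length w
  pinned (φ , _ , φ-letters) =
    to (lookup-doubled≡fromℕ⇔ w (φ i)) (trans (φ-letters i) C[i]≡fromℕ)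

doubled-sPrimitive : ∀ {N} (w : Word N) → SPrimitive w → SPrimitive (doubled w)
doubled-sPrimitive w w-prim C cover |C|<|S| with sCover-doubled-pinned w {C} cover
... | i , pinned = <⇒≱ |C|<|S| (begin
    length S                                  ≡⟨ length-doubled w ⟩
    G + suc G                                 ≤⟨ +-mono-≤ G≤i (s≤s G≤rest) ⟩
    toℕ i + suc (length C ∸ suc (toℕ i))      ≡⟨ +-suc (toℕ i) _ ⟩
    suc (toℕ i) + (length C ∸ suc (toℕ i))    ≡⟨ m+[n∸m]≡n (toℕ<n i) ⟩
    length C                                  ∎)
  where
  open ≤-Reasoning
  G : ℕ
  G = length w
  S : Word _
  S = doubled w
  G≤i : G ≤ toℕ i
  G≤i = AlignedBlock.sPrimitive-≤-block inject₁-injective {w = w} {C = C} {S = S} cover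
          (doubled-factorˡ w) (<⇒≤ (toℕ<n i))
          (λ o → prefix-aligned {C = C} {S = S} o i (pinned o)) w-prim
  G≤rest : G ≤ length C ∸ suc (toℕ i)
  G≤rest = AlignedBlock.sPrimitive-≤-block inject₁-injective {w = w} {C = C} {S = S} cover
          (doubled-factorʳ w) (≤-reflexive (m+[n∸m]≡n (toℕ<n i)))
          (λ o → suffix-aligned {C = C} {S = S} o i (pinned o)
                   (sym (trans (length-doubled w) (+-suc G G)))) w-prim

lemma3 : ∀ (k : ℕ) → 2 ≤ k → ∀ (g : ℕ) → IsGamma (k ∸ 1) g →
    GammaAtLeast k (2 * g + 1)
lemma3 0             ()
lemma3 1             (s≤s ())
lemma3 (suc (suc n)) _ g ((w , w-prim , |w|≡g) , _) =
  doubled w , doubled-sPrimitive w w-prim , ≤-reflexive (begin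
    2 * g + 1                  ≡⟨ 2g+1≡g+suc-g g ⟩
    g + suc g                  ≡⟨ cong (λ n → n + suc n) (sym |w|≡g) ⟩
    length w + suc (length w)  ≡⟨ sym (length-doubled w) ⟩
    length (doubled w)         ∎)
  where
  open ≡-Reasoning
  2g+1≡g+suc-g : ∀ g → 2 * g + 1 ≡ g + suc g
  2g+1≡g+suc-g = solve-∀
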